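{- Let $G$ be a connected graph which is $(\text{claw}, \text{diamond}, \text{net})$-free. Then $G$ contains $K_4$ or $G$ is $3$-colorable.
   Context: All graphs are finite, simple and undirected. For graphs $G$ and $F$, "$G$ contains $F$" means that some induced subgraph of $G$ is isomorphic to $F$; $G$ is $(F_1,\dots,F_m)$-free if it contains none of $F_1,\dots,F_m$. The claw is $K_{1,3}$. The diamond is $K_4$ with one edge deleted. The net is the graph obtained from a triangle by attaching one pendant edge at each of its three vertices (six vertices in total). A graph is $3$-colorable if it admits a proper vertex coloring with at most $3$ colors. -}

module Defs where

open import Data.Nat using (ℕ; zero; suc)
open import Data.Fin using (Fin; zero; suc)
open import Data.Bool using (Bool; true; false; _∧_; _∨_; not)
open import Data.Product using (Σ; ∃; _×_; _,_)
open import Data.Empty using (⊥)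
open import Data.List using (List; []; _∷_)
open import Relation.Binary.PropositionalEquality using (_≡_; _≢_)
open import Function.Definitions using (Injective)

record Graph : Set where
  field
    size  : ℕ
    adj   : Fin size → Fin size → Bool
    sym   : ∀ u v → adj u v ≡ adj v u
    irrefl : ∀ v → adj v v ≡ false
open Graph public

Vertex : Graph → Set
Vertex G = Fin (size G)

record Contains (G F : Graph) : Set where
  field
    emb       : Vertex F → Vertex G
    injective : Injective _≡_ _≡_ emb
    preserves : ∀ u v → adj G (emb u) (emb v) ≡ adj F u v

data Walk (G : Graph) : Vertex G → Vertex G → Set where
  here : ∀ {v} → Walk G v v
  step : ∀ {u v w} → adj G u v ≡ true → Walk G v w → Walk G u w

Connected : Graph → Set
Connected G = ∀ u v → Walk G u v

Colorable : ℕ → Graph → Set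
Colorable k G = Σ (Vertex G → Fin k) λ c →
  ∀ u v → adj G u v ≡ true → c u ≢ c v

_==_ : ∀ {n} → Fin n → Fin n → Bool
zero  == zero  = true
zero  == suc _ = false
suc _ == zero  = false
suc i == suc j = i == j

K : ℕ → Graph
K n = record
  { size = n ; adj = λ u v → not (u == v)
  ; sym = symK ; irrefl = irrK }
  where
    symK : ∀ {m} (u v : Fin m) → not (u == v) ≡ not (v == u)
    symK zero zero = _≡_.refl
    symK zero (suc v) = _≡_.refl
    symK (suc u) zero = _≡_.refl
    symK (suc u) (suc v) = symK u v
    irrK : ∀ {m} (v : Fin m) → not (v == v) ≡ false
    irrK zero = _≡_.refl
    irrK (suc v) = irrK v

clawAdj : Fin 4 → Fin 4 → Bool
clawAdj zero (suc _) = true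
clawAdj (suc _) zero = true
clawAdj _ _ = false

claw : Graph
claw = record { size = 4 ; adj = clawAdj ; sym = s ; irrefl = i }
  where
    s : ∀ u v → clawAdj u v ≡ clawAdj v u
    s zero zero = _≡_.refl
    s zero (suc v) = _≡_.refl
    s (suc u) zero = _≡_.refl
    s (suc u) (suc v) = _≡_.refl
    i : ∀ v → clawAdj v v ≡ false
    i zero = _≡_.refl
    i (suc v) = _≡_.refl

diamondAdj : Fin 4 → Fin 4 → Bool
diamondAdj u v = not (u == v) ∧ not ((u == two ∧ v == three) ∨ (u == three ∧ v == two))
  where
    two three : Fin 4
    two = suc (suc zero)
    three = suc (suc (suc zero))

diamond : Graph
diamond = record { size = 4 ; adj = diamondAdj ; sym = s ; irrefl = i }
  where
    s : ∀ u v → diamondAdj u v ≡ diamondAdj v u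
    s zero zero = _≡_.refl
    s zero (suc zero) = _≡_.refl
    s zero (suc (suc zero)) = _≡_.refl
    s zero (suc (suc (suc zero))) = _≡_.refl
    s (suc zero) zero = _≡_.refl
    s (suc zero) (suc zero) = _≡_.refl
    s (suc zero) (suc (suc zero)) = _≡_.refl
    s (suc zero) (suc (suc (suc zero))) = _≡_.refl
    s (suc (suc zero)) zero = _≡_.refl
    s (suc (suc zero)) (suc zero) = _≡_.refl
    s (suc (suc zero)) (suc (suc zero)) = _≡_.refl
    s (suc (suc zero)) (suc (suc (suc zero))) = _≡_.refl
    s (suc (suc (suc zero))) zero = _≡_.refl
    s (suc (suc (suc zero))) (suc zero) = _≡_.refl
    s (suc (suc (suc zero))) (suc (suc zero)) = _≡_.refl
    s (suc (suc (suc zero))) (suc (suc (suc zero))) = _≡_.refl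
    i : ∀ v → diamondAdj v v ≡ false
    i zero = _≡_.refl
    i (suc zero) = _≡_.refl
    i (suc (suc zero)) = _≡_.refl
    i (suc (suc (suc zero))) = _≡_.refl

edgeIn : ∀ {n} → List (Fin n × Fin n) → Fin n → Fin n → Bool
edgeIn [] u v = false
edgeIn ((a , b) ∷ es) u v =
  ((a == u ∧ b == v) ∨ (a == v ∧ b == u)) ∨ edgeIn es u v

v0 v1 v2 v3 v4 v5 : Fin 6
v0 = zero
v1 = suc zero
v2 = suc (suc zero)
v3 = suc (suc (suc zero))
v4 = suc (suc (suc (suc zero)))
v5 = suc (suc (suc (suc (suc zero))))

netEdges : List (Fin 6 × Fin 6)
netEdges = (v0 , v1) ∷ (v1 , v2) ∷ (v0 , v2) ∷ (v0 , v3) ∷ (v1 , v4) ∷ (v2 , v5) ∷ []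

netAdj : Fin 6 → Fin 6 → Bool
netAdj = edgeIn netEdges

net : Graph
net = record { size = 6 ; adj = netAdj ; sym = s ; irrefl = i }
  where
    s : ∀ u v → netAdj u v ≡ netAdj v u
    s zero zero = _≡_.refl
    s zero (suc zero) = _≡_.refl
    s zero (suc (suc zero)) = _≡_.refl
    s zero (suc (suc (suc zero))) = _≡_.refl
    s zero (suc (suc (suc (suc zero)))) = _≡_.refl
    s zero (suc (suc (suc (suc (suc zero))))) = _≡_.refl
    s (suc zero) zero = _≡_.refl
    s (suc zero) (suc zero) = _≡_.refl
    s (suc zero) (suc (suc zero)) = _≡_.refl
    s (suc zero) (suc (suc (suc zero))) = _≡_.refl
    s (suc zero) (suc (suc (suc (suc zero)))) = _≡_.refl
    s (suc zero) (suc (suc (suc (suc (suc zero))))) = _≡_.refl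
    s (suc (suc zero)) zero = _≡_.refl
    s (suc (suc zero)) (suc zero) = _≡_.refl
    s (suc (suc zero)) (suc (suc zero)) = _≡_.refl
    s (suc (suc zero)) (suc (suc (suc zero))) = _≡_.refl
    s (suc (suc zero)) (suc (suc (suc (suc zero)))) = _≡_.refl
    s (suc (suc zero)) (suc (suc (suc (suc (suc zero))))) = _≡_.refl
    s (suc (suc (suc zero))) zero = _≡_.refl
    s (suc (suc (suc zero))) (suc zero) = _≡_.refl
    s (suc (suc (suc zero))) (suc (suc zero)) = _≡_.refl
    s (suc (suc (suc zero))) (suc (suc (suc zero))) = _≡_.refl
    s (suc (suc (suc zero))) (suc (suc (suc (suc zero)))) = _≡_.refl
    s (suc (suc (suc zero))) (suc (suc (suc (suc (suc zero))))) = _≡_.refl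
    s (suc (suc (suc (suc zero)))) zero = _≡_.refl
    s (suc (suc (suc (suc zero)))) (suc zero) = _≡_.refl
    s (suc (suc (suc (suc zero)))) (suc (suc zero)) = _≡_.refl
    s (suc (suc (suc (suc zero)))) (suc (suc (suc zero))) = _≡_.refl
    s (suc (suc (suc (suc zero)))) (suc (suc (suc (suc zero)))) = _≡_.refl
    s (suc (suc (suc (suc zero)))) (suc (suc (suc (suc (suc zero))))) = _≡_.refl
    s (suc (suc (suc (suc (suc zero))))) zero = _≡_.refl
    s (suc (suc (suc (suc (suc zero))))) (suc zero) = _≡_.refl
    s (suc (suc (suc (suc (suc zero))))) (suc (suc zero)) = _≡_.refl
    s (suc (suc (suc (suc (suc zero))))) (suc (suc (suc zero))) = _≡_.refl
    s (suc (suc (suc (suc (suc zero))))) (suc (suc (suc (suc zero)))) = _≡_.refl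
    s (suc (suc (suc (suc (suc zero))))) (suc (suc (suc (suc (suc zero))))) = _≡_.refl
    i : ∀ v → netAdj v v ≡ false
    i zero = _≡_.refl
    i (suc zero) = _≡_.refl
    i (suc (suc zero)) = _≡_.refl
    i (suc (suc (suc zero))) = _≡_.refl
    i (suc (suc (suc (suc zero)))) = _≡_.refl
    i (suc (suc (suc (suc (suc zero))))) = _≡_.refl

Free : Graph → Graph → Set
Free G F = Contains G F → ⊥

{-# OPTIONS --safe #-}
-- Argue on a minimal vertex set S that has no proper 3-colouring (formally: by
-- well-founded induction on subsets).  A vertex with at most two neighbours in S could be
-- coloured last, so every vertex has at least three.  Claw- and diamond-freeness make every
-- neighbourhood the disjoint union of at most two cliques, each of size at most two once K₄
-- is excluded.  Hence S contains a triangle x₁x₂x₃ in which each xᵢ has either exactly one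
-- further neighbour pᵢ or exactly two further neighbours aᵢ ~ bᵢ.  Net-freeness then forces
-- enough edges among these outer vertices that one of three configurations appears: the
-- 4-cycle x₁x₂p₂p₁, the single vertex x₁, or the triangle itself.  For each of them every
-- proper colouring of its boundary extends inside (checked by exhaustive computation), so
-- a colouring of the smaller set S minus the configuration extends to S.
module Submission where

open import Defs hiding (sym)

open import Data.Bool using (Bool; true; false; if_then_else_; _∧_; _∨_)
open import Data.Bool.Properties using () renaming (_≟_ to _≟ᵇ_)
open import Data.Empty using (⊥; ⊥-elim)
open import Data.Fin using (Fin; zero; suc; _<_; #_)
open import Data.Fin.Properties using (<-cmp; all?; any?; ¬∀⟶∃¬) renaming (_≟_ to _≟ᶠ_)
open import Data.Fin.Subset using (Subset; _∈_; _∉_; _─_; _⊂_; ⁅_⁆; ⊤)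
open import Data.Fin.Subset.Induction using (⊂-wellFounded)
open import Data.Fin.Subset.Properties
  using (_∈?_; x∈p∧x∉q⇒x∈p─q; p∩q≢∅⇒p─q⊂p; x∈p∩q⁺; x∈p⇒p-x⊂p; x∈⁅y⁆⇒x≡y; ∈⊤)
open import Data.List using (List; []; _∷_)
import Data.List.Relation.Unary.All as Listᴬ
open Listᴬ using ([]; _∷_)
open import Data.Nat using (ℕ; zero; suc; s≤s)
open import Data.Product using (Σ; ∃; _×_; _,_; proj₁; proj₂)
open import Data.Sum using (_⊎_; inj₁; inj₂)
import Data.Sum as Sum
open import Data.Unit using (tt)
open import Data.Vec using (Vec; []; _∷_; lookup; tabulate; allFin)
open import Data.Vec.Properties using (lookup∘tabulate; []=⇒lookup; lookup⇒[]=)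
open import Data.Vec.Relation.Unary.All using (All; []; _∷_)
import Data.Vec.Relation.Unary.All.Properties as Vecᴬ
open import Data.Vec.Relation.Unary.AllPairs using (AllPairs; []; _∷_)
open import Data.Vec.Relation.Unary.Unique.Propositional using (Unique)
open import Data.Vec.Relation.Unary.Unique.Propositional.Properties using (lookup-injective)
open import Function using (_∘_)
open import Induction.WellFounded using (module All)
open import Relation.Binary using (tri<; tri≈; tri>)
open import Relation.Binary.PropositionalEquality using (_≡_; _≢_; refl; sym; trans; cong)
open import Relation.Nullary using (Dec; yes; no; does; ¬_)
open import Relation.Nullary.Decidable using (toWitness; dec-true; map′; _×-dec_; _⊎-dec_; _→-dec_; ¬?)

AllPairs-tabulate⁻ : ∀ {a ℓ} {A : Set a} {R : A → A → Set ℓ} {n} {f : Fin n → A} →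
                     AllPairs R (tabulate f) → ∀ {i j} → i < j → R (f i) (f j)
AllPairs-tabulate⁻ (px ∷ _)   {zero}  {suc j} _         = Vecᴬ.tabulate⁻ px j
AllPairs-tabulate⁻ (_  ∷ pxs) {suc i} {suc j} (s≤s i<j) = AllPairs-tabulate⁻ pxs i<j

image : ∀ {k n} → (Fin k → Fin n) → Subset n
image r = tabulate λ v → does (any? λ i → v ≟ᶠ r i)

∈-image⁺ : ∀ {k n} (r : Fin k → Fin n) i → r i ∈ image r
∈-image⁺ r i = lookup⇒[]= (r i) (image r) (trans (lookup∘tabulate _ (r i)) (dec-true (any? _) (i , refl)))

∈-image⁻ : ∀ {k n} (r : Fin k → Fin n) {v} → v ∈ image r → ∃ λ i → v ≡ r i
∈-image⁻ r {v} v∈r with any? (λ i → v ≟ᶠ r i) | trans (sym (lookup∘tabulate _ v)) ([]=⇒lookup v∈r)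
... | yes found | _  = found
... | no _      | ()

all-vec? : ∀ {k} m {P : Vec (Fin k) m → Set} → (∀ f → Dec (P f)) → Dec (∀ f → P f)
all-vec? zero    P? = map′ (λ { p [] → p }) (λ h → h []) (P? [])
all-vec? (suc m) P? = map′ (λ h → λ { (x ∷ f) → h x f }) (λ h x f → h (x ∷ f))
  (all? λ x → all-vec? m λ f → P? (x ∷ f))

any-vec? : ∀ {k} m {P : Vec (Fin k) m → Set} → (∀ f → Dec (P f)) → Dec (∃ P)
any-vec? zero    P? = map′ ([] ,_) (λ { ([] , p) → p }) (P? [])
any-vec? (suc m) P? = map′ (λ { (x , f , p) → x ∷ f , p }) (λ { (x ∷ f , p) → x , f , p })
  (any? λ x → any-vec? m λ f → P? (x ∷ f))

fresh-colour : ∀ (a b : Fin 3) → ∃ λ k → k ≢ a × k ≢ b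
fresh-colour = toWitness {a? = all? λ a → all? λ b → any? λ k → ¬? (k ≟ᶠ a) ×-dec ¬? (k ≟ᶠ b)} tt

swap-first-two : ∀ {a b c} {A : Set a} {B : Set b} {C : Set c} → A ⊎ B ⊎ C → B ⊎ A ⊎ C
swap-first-two = Sum.assocʳ ∘ Sum.map₁ Sum.swap ∘ Sum.assocˡ

-- Reducible configurations

record Configuration : Set where
  field
    inner outer : ℕ
    innerAdj    : Fin inner → Fin inner → Bool
    link        : Fin inner → Fin outer → Bool
    outerEdges  : List (Fin outer × Fin outer)

module _ (C : Configuration) where
  open Configuration C

  Extends : Vec (Fin 3) outer → Vec (Fin 3) inner → Set
  Extends f κ = (∀ i j → innerAdj i j ≡ true → lookup κ i ≢ lookup κ j) ×
                (∀ i l → link i l ≡ true → lookup κ i ≢ lookup f l)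

  Extendable : Set
  Extendable = ∀ f → Listᴬ.All (λ (l , l') → lookup f l ≢ lookup f l') outerEdges → ∃ (Extends f)

  extendable? : Dec Extendable
  extendable? = all-vec? outer λ f →
    Listᴬ.all? (λ (l , l') → ¬? (lookup f l ≟ᶠ lookup f l')) outerEdges →-dec any-vec? inner λ κ →
      (all? λ i → all? λ j → (innerAdj i j ≟ᵇ true) →-dec ¬? (lookup κ i ≟ᶠ lookup κ j)) ×-dec
      (all? λ i → all? λ l → (link i l ≟ᵇ true) →-dec ¬? (lookup κ i ≟ᶠ lookup f l))

pairIn : ∀ {k m} → List (Fin k × Fin m) → Fin k → Fin m → Bool
pairIn []             i l = false
pairIn ((a , b) ∷ ps) i l = (a == i ∧ b == l) ∨ pairIn ps i l

C4-configuration : Configuration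
C4-configuration = record
  { inner    = 4
  ; outer    = 3
  ; innerAdj = edgeIn ((# 0 , # 1) ∷ (# 1 , # 2) ∷ (# 2 , # 3) ∷ (# 3 , # 0) ∷ [])
  ; link     = pairIn ((# 0 , # 0) ∷ (# 1 , # 0) ∷ (# 2 , # 1) ∷ (# 3 , # 2) ∷ [])
  ; outerEdges = []
  }

-- The outer edges prevent the three neighbours 0, 1, 2 of the inner vertex from receiving
-- three different colours.
K1-configuration : Configuration
K1-configuration = record
  { inner    = 1
  ; outer    = 7
  ; innerAdj = edgeIn []
  ; link     = pairIn ((# 0 , # 0) ∷ (# 0 , # 1) ∷ (# 0 , # 2) ∷ [])
  ; outerEdges = (# 0 , # 3) ∷ (# 0 , # 4) ∷ (# 3 , # 4) ∷ (# 1 , # 5) ∷ (# 1 , # 6) ∷ (# 5 , # 6) ∷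
                 (# 2 , # 3) ∷ (# 2 , # 5) ∷ (# 4 , # 6) ∷ []
  }

K3-configuration : Configuration
K3-configuration = record
  { inner    = 3
  ; outer    = 6
  ; innerAdj = edgeIn ((# 0 , # 1) ∷ (# 0 , # 2) ∷ (# 1 , # 2) ∷ [])
  ; link     = pairIn ((# 0 , # 0) ∷ (# 0 , # 1) ∷ (# 1 , # 2) ∷ (# 1 , # 3) ∷ (# 2 , # 4) ∷ (# 2 , # 5) ∷ [])
  ; outerEdges = (# 0 , # 1) ∷ (# 2 , # 3) ∷ (# 4 , # 5) ∷ (# 0 , # 2) ∷ (# 2 , # 4) ∷ (# 0 , # 4) ∷
                 (# 1 , # 3) ∷ (# 3 , # 5) ∷ (# 1 , # 5) ∷ []
  }

C4-extendable : Extendable C4-configuration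
C4-extendable = toWitness {a? = extendable? C4-configuration} tt

K1-extendable : Extendable K1-configuration
K1-extendable = toWitness {a? = extendable? K1-configuration} tt

K3-extendable : Extendable K3-configuration
K3-extendable = toWitness {a? = extendable? K3-configuration} tt

module _ (G : Graph) where

  V : Set
  V = Vertex G

  infix 4 _~_ _≁_
  _~_ _≁_ : V → V → Set
  u ~ v = adj G u v ≡ true
  u ≁ v = adj G u v ≡ false

  adj-sym : ∀ {u v b} → adj G u v ≡ b → adj G v u ≡ b
  adj-sym {u} {v} = trans (Graph.sym G v u)

  ~∧≁⇒⊥ : ∀ {u v} → u ~ v → u ≁ v → ⊥
  ~∧≁⇒⊥ u~v u≁v with trans (sym u~v) u≁v
  ... | ()

  ~⇒≢ : ∀ {u v} → u ~ v → u ≢ v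
  ~⇒≢ {u} u~u refl = ~∧≁⇒⊥ u~u (irrefl G u)

  separated⇒≢ : ∀ {u v w} → u ~ w → v ≁ w → u ≢ v
  separated⇒≢ u~w u≁w refl = ~∧≁⇒⊥ u~w u≁w

  ~-or-≁ : ∀ u v → u ~ v ⊎ u ≁ v
  ~-or-≁ u v with adj G u v
  ... | true  = inj₁ refl
  ... | false = inj₂ refl

  Faithful : (F : Graph) → (Vertex F → V) → Vertex F → Vertex F → Set
  Faithful F e i j = adj G (e i) (e j) ≡ adj F i j × (adj F i j ≡ false → e i ≢ e j)

  induced-copy : (F : Graph) (e : Vertex F → V) →
                 AllPairs (Faithful F e) (allFin (size F)) → Contains G F
  induced-copy F e faithful = record
    { emb = e ; injective = λ {i} {j} → injective i j ; preserves = preserves }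
    where
      upper : ∀ {i j} → i < j → Faithful F e i j
      upper = AllPairs-tabulate⁻ faithful

      faithful⇒≢ : ∀ {a b} (s : Bool) → adj G a b ≡ s → (s ≡ false → a ≢ b) → a ≢ b
      faithful⇒≢ true  a~b _        = ~⇒≢ a~b
      faithful⇒≢ false _   distinct = distinct refl

      preserves : ∀ i j → adj G (e i) (e j) ≡ adj F i j
      preserves i j with <-cmp i j
      ... | tri< i<j _ _ = proj₁ (upper i<j)
      ... | tri≈ _ refl _ = trans (irrefl G (e i)) (sym (irrefl F i))
      ... | tri> _ _ j<i = trans (adj-sym (proj₁ (upper j<i))) (Graph.sym F j i)

      injective : ∀ i j → e i ≡ e j → i ≡ j
      injective i j ei≡ej with <-cmp i j
      ... | tri< i<j _ _ = ⊥-elim (faithful⇒≢ _ (proj₁ (upper i<j)) (proj₂ (upper i<j)) ei≡ej)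
      ... | tri≈ _ i≡j _ = i≡j
      ... | tri> _ _ j<i = ⊥-elim (faithful⇒≢ _ (proj₁ (upper j<i)) (proj₂ (upper j<i)) (sym ei≡ej))

  K4-copy : ∀ {a b c d} → a ~ b → a ~ c → a ~ d → b ~ c → b ~ d → c ~ d → Contains G (K 4)
  K4-copy {a} {b} {c} {d} ab ac ad bc bd cd =
    induced-copy (K 4) (lookup (a ∷ b ∷ c ∷ d ∷ []))
      (((ab , λ ()) ∷ (ac , λ ()) ∷ (ad , λ ()) ∷ []) ∷
       ((bc , λ ()) ∷ (bd , λ ()) ∷ []) ∷
       ((cd , λ ()) ∷ []) ∷ [] ∷ [])

  contains-K4-or-free : Contains G (K 4) ⊎ Free G (K 4)
  contains-K4-or-free with any? (λ a → any? λ b → any? λ c → any? λ d →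
    (adj G a b ≟ᵇ true) ×-dec (adj G a c ≟ᵇ true) ×-dec (adj G a d ≟ᵇ true) ×-dec
    (adj G b c ≟ᵇ true) ×-dec (adj G b d ≟ᵇ true) ×-dec (adj G c d ≟ᵇ true))
  ... | yes (_ , _ , _ , _ , ab , ac , ad , bc , bd , cd) = inj₁ (K4-copy ab ac ad bc bd cd)
  ... | no none = inj₂ λ copy → let open Contains copy in none
    ( emb (# 0) , emb (# 1) , emb (# 2) , emb (# 3)
    , preserves (# 0) (# 1) , preserves (# 0) (# 2) , preserves (# 0) (# 3)
    , preserves (# 1) (# 2) , preserves (# 1) (# 3) , preserves (# 2) (# 3) )

  Colouring : Set
  Colouring = V → Fin 3

  ProperOn : Subset (size G) → Colouring → Set
  ProperOn S c = ∀ {u v} → u ∈ S → v ∈ S → u ~ v → c u ≢ c v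

  ColourableOn : Subset (size G) → Set
  ColourableOn S = Σ Colouring (ProperOn S)

  override : Subset (size G) → Colouring → Colouring → Colouring
  override R κ c v = if does (v ∈? R) then κ v else c v

  glue : ∀ {S} R {κ c} → ProperOn (S ─ R) c →
         (∀ {u v} → v ∈ S → u ∈ R → v ∈ R → u ~ v → κ u ≢ κ v) →
         (∀ {u v} → v ∈ S → u ∈ R → v ∉ R → u ~ v → κ u ≢ c v) →
         ProperOn S (override R κ c)
  glue R proper inner-edges boundary-edges {u} {v} u∈S v∈S u~v with u ∈? R | v ∈? R
  ... | yes u∈R | yes v∈R = inner-edges v∈S u∈R v∈R u~v
  ... | yes u∈R | no v∉R  = boundary-edges v∈S u∈R v∉R u~v
  ... | no u∉R  | yes v∈R = λ eq → boundary-edges u∈S v∈R u∉R (adj-sym u~v) (sym eq)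
  ... | no u∉R  | no v∉R  = proper (x∈p∧x∉q⇒x∈p─q u∈S u∉R) (x∈p∧x∉q⇒x∈p─q v∈S v∉R) u~v

  ProperSubsetsColourable : Subset (size G) → Set
  ProperSubsetsColourable S = ∀ {S'} → S' ⊂ S → ColourableOn S'

  NeighboursAmong : Subset (size G) → V → V → V → Set
  NeighboursAmong S v y z = ∀ w → w ∈ S → v ~ w → w ≡ y ⊎ w ≡ z

  low-vertex-removable : ∀ {S v y z} → ProperSubsetsColourable S → v ∈ S → NeighboursAmong S v y z → ColourableOn S
  low-vertex-removable {S} {v} {y} {z} subsets-colourable v∈S low =
    override ⁅ v ⁆ (λ _ → k) c , glue ⁅ v ⁆ proper inner-edge boundary-edges
    where
      c : Colouring
      c = proj₁ (subsets-colourable (x∈p⇒p-x⊂p v∈S))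

      proper : ProperOn (S ─ ⁅ v ⁆) c
      proper = proj₂ (subsets-colourable (x∈p⇒p-x⊂p v∈S))

      k : Fin 3
      k = proj₁ (fresh-colour (c y) (c z))

      inner-edge : ∀ {u w} → w ∈ S → u ∈ ⁅ v ⁆ → w ∈ ⁅ v ⁆ → u ~ w → k ≢ k
      inner-edge _ u∈v w∈v u~w = ⊥-elim (~⇒≢ u~w (trans (x∈⁅y⁆⇒x≡y v u∈v) (sym (x∈⁅y⁆⇒x≡y v w∈v))))

      boundary-edges : ∀ {u w} → w ∈ S → u ∈ ⁅ v ⁆ → w ∉ ⁅ v ⁆ → u ~ w → k ≢ c w
      boundary-edges w∈S u∈v _ u~w with x∈⁅y⁆⇒x≡y v u∈v
      ... | refl with low _ w∈S u~w
      ...   | inj₁ refl = proj₁ (proj₂ (fresh-colour (c y) (c z)))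
      ...   | inj₂ refl = proj₂ (proj₂ (fresh-colour (c y) (c z)))

  low-vertex? : ∀ S → Dec (∃ λ v → v ∈ S × ∃ λ y → ∃ λ z → NeighboursAmong S v y z)
  low-vertex? S = any? λ v → v ∈? S ×-dec (any? λ y → any? λ z → all? λ w →
    w ∈? S →-dec (adj G v w ≟ᵇ true) →-dec (w ≟ᶠ y ⊎-dec w ≟ᶠ z))

  Degree≥3 : Subset (size G) → Set
  Degree≥3 S = ∀ {v} → v ∈ S → ∀ y z → ∃ λ w → w ∈ S × v ~ w × w ≢ y × w ≢ z

  no-low-vertex⇒degree≥3 : ∀ {S} → ¬ (∃ λ v → v ∈ S × ∃ λ y → ∃ λ z → NeighboursAmong S v y z) → Degree≥3 S
  no-low-vertex⇒degree≥3 {S} none {v} v∈S y z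
    with ¬∀⟶∃¬ _ _ (λ w → w ∈? S →-dec (adj G v w ≟ᵇ true) →-dec (w ≟ᶠ y ⊎-dec w ≟ᶠ z))
                   (λ low → none (v , v∈S , y , z , low))
  ... | w , not-low with w ∈? S | ~-or-≁ v w
  ...   | no w∉S  | _        = ⊥-elim (not-low λ w∈S → ⊥-elim (w∉S w∈S))
  ...   | yes _   | inj₂ v≁w = ⊥-elim (not-low λ _ v~w → ⊥-elim (~∧≁⇒⊥ v~w v≁w))
  ...   | yes w∈S | inj₁ v~w =
    w , w∈S , v~w , (λ w≡y → not-low λ _ _ → inj₁ w≡y) , (λ w≡z → not-low λ _ _ → inj₂ w≡z)

  Closed : ∀ C → Subset (size G) → Vec V (Configuration.inner C) → Vec V (Configuration.outer C) → Set
  Closed C S inners outers = ∀ i {w} → w ∈ S → lookup inners i ~ w →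
    (∃ λ j → w ≡ lookup inners j × innerAdj i j ≡ true) ⊎ (∃ λ l → w ≡ lookup outers l × link i l ≡ true)
    where open Configuration C

  record Placement (C : Configuration) (S : Subset (size G)) : Set where
    open Configuration C
    field
      inners        : Vec V inner
      outers        : Vec V outer
      inners∈S      : All (_∈ S) inners
      outers∈S      : All (_∈ S) outers
      inners-unique : Unique inners
      outers∉inners : All (λ o → All (o ≢_) inners) outers
      outer-edges   : Listᴬ.All (λ (l , l') → lookup outers l ~ lookup outers l') outerEdges
      closed        : Closed C S inners outers

  reduce : ∀ {S} C → Extendable C → Fin (Configuration.inner C) → Placement C S → ProperSubsetsColourable S →
           ColourableOn S
  reduce {S} C extendable i₀ placement subsets-colourable =
    override R colourInner c , glue R proper inner-edges boundary-edges
    where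
      open Configuration C
      open Placement placement

      innerV : Fin inner → V
      innerV = lookup inners

      outerV : Fin outer → V
      outerV = lookup outers

      R : Subset (size G)
      R = image innerV

      innerV∈S : ∀ i → innerV i ∈ S
      innerV∈S = Vecᴬ.lookup⁺ inners∈S

      outerV∈S─R : ∀ l → outerV l ∈ S ─ R
      outerV∈S─R l = x∈p∧x∉q⇒x∈p─q (Vecᴬ.lookup⁺ outers∈S l) outerV∉R
        where
          outerV∉R : outerV l ∉ R
          outerV∉R o∈R with ∈-image⁻ innerV o∈R
          ... | i , o≡i = Vecᴬ.lookup⁺ (Vecᴬ.lookup⁺ outers∉inners l) i o≡i

      S─R⊂S : S ─ R ⊂ S
      S─R⊂S = p∩q≢∅⇒p─q⊂p S R (innerV i₀ , x∈p∩q⁺ (innerV∈S i₀ , ∈-image⁺ innerV i₀))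

      c : Colouring
      c = proj₁ (subsets-colourable S─R⊂S)

      proper : ProperOn (S ─ R) c
      proper = proj₂ (subsets-colourable S─R⊂S)

      f : Vec (Fin 3) outer
      f = tabulate (c ∘ outerV)

      f-proper : ∀ {l l'} → outerV l ~ outerV l' → lookup f l ≢ lookup f l'
      f-proper {l} {l'} o~o' rewrite lookup∘tabulate (c ∘ outerV) l | lookup∘tabulate (c ∘ outerV) l' =
        proper (outerV∈S─R l) (outerV∈S─R l') o~o'

      extension : ∃ (Extends C f)
      extension = extendable f (Listᴬ.map f-proper outer-edges)

      κ : Vec (Fin 3) inner
      κ = proj₁ extension

      colourInner : Colouring
      colourInner v with any? (λ i → v ≟ᶠ innerV i)
      ... | yes (i , _) = lookup κ i
      ... | no _        = zero

      colourInner-innerV : ∀ i → colourInner (innerV i) ≡ lookup κ i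
      colourInner-innerV i with any? (λ j → innerV i ≟ᶠ innerV j)
      ... | yes (j , i≡j) = cong (lookup κ) (lookup-injective inners-unique j i (sym i≡j))
      ... | no none       = ⊥-elim (none (i , refl))

      inner-edges : ∀ {u v} → v ∈ S → u ∈ R → v ∈ R → u ~ v → colourInner u ≢ colourInner v
      inner-edges v∈S u∈R v∈R u~v with ∈-image⁻ innerV u∈R | ∈-image⁻ innerV v∈R
      ... | i , refl | j , refl rewrite colourInner-innerV i | colourInner-innerV j
        with closed i v∈S u~v
      ... | inj₁ (j' , e , i~j') rewrite lookup-injective inners-unique j j' e = proj₁ (proj₂ extension) i j' i~j'
      ... | inj₂ (l , e , _) = ⊥-elim (Vecᴬ.lookup⁺ (Vecᴬ.lookup⁺ outers∉inners l) j (sym e))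

      boundary-edges : ∀ {u v} → v ∈ S → u ∈ R → v ∉ R → u ~ v → colourInner u ≢ c v
      boundary-edges v∈S u∈R v∉R u~v with ∈-image⁻ innerV u∈R
      ... | i , refl rewrite colourInner-innerV i with closed i v∈S u~v
      ... | inj₁ (j , refl , _)   = ⊥-elim (v∉R (∈-image⁺ innerV j))
      ... | inj₂ (l , refl , i-l) rewrite sym (lookup∘tabulate (c ∘ outerV) l) = proj₂ (proj₂ extension) i l i-l

  -- Local structure of (claw, diamond, net, K₄)-free graphs

  module Forbidden (claw-free : Free G claw) (diamond-free : Free G diamond)
                   (net-free : Free G net) (K4-free : Free G (K 4)) where

    no-claw : ∀ {x a b c} → x ~ a → x ~ b → x ~ c → a ≁ b → a ≁ c → b ≁ c →
              a ≢ b → a ≢ c → b ≢ c → ⊥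
    no-claw {x} {a} {b} {c} xa xb xc ab ac bc a≢b a≢c b≢c =
      claw-free (induced-copy claw (lookup (x ∷ a ∷ b ∷ c ∷ []))
        (((xa , λ ()) ∷ (xb , λ ()) ∷ (xc , λ ()) ∷ []) ∷
         ((ab , λ _ → a≢b) ∷ (ac , λ _ → a≢c) ∷ []) ∷
         ((bc , λ _ → b≢c) ∷ []) ∷ [] ∷ []))

    no-diamond : ∀ {x y a b} → x ~ y → x ~ a → x ~ b → y ~ a → y ~ b → a ≁ b → a ≢ b → ⊥
    no-diamond {x} {y} {a} {b} xy xa xb ya yb ab a≢b =
      diamond-free (induced-copy diamond (lookup (x ∷ y ∷ a ∷ b ∷ []))
        (((xy , λ ()) ∷ (xa , λ ()) ∷ (xb , λ ()) ∷ []) ∷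
         ((ya , λ ()) ∷ (yb , λ ()) ∷ []) ∷
         ((ab , λ _ → a≢b) ∷ []) ∷ [] ∷ []))

    no-K4 : ∀ {a b c d} → a ~ b → a ~ c → a ~ d → b ~ c → b ~ d → c ~ d → ⊥
    no-K4 ab ac ad bc bd cd = K4-free (K4-copy ab ac ad bc bd cd)

    no-net : ∀ {x₁ x₂ x₃ y₁ y₂ y₃} → x₁ ~ x₂ → x₁ ~ x₃ → x₂ ~ x₃ →
             x₁ ~ y₁ → x₂ ~ y₂ → x₃ ~ y₃ →
             x₁ ≁ y₂ → x₁ ≁ y₃ → x₂ ≁ y₁ → x₂ ≁ y₃ → x₃ ≁ y₁ → x₃ ≁ y₂ →
             y₁ ≁ y₂ → y₁ ≁ y₃ → y₂ ≁ y₃ → ⊥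
    no-net {x₁} {x₂} {x₃} {y₁} {y₂} {y₃} x₁₂ x₁₃ x₂₃ x₁y₁ x₂y₂ x₃y₃ x₁y₂ x₁y₃ x₂y₁ x₂y₃ x₃y₁ x₃y₂ y₁₂ y₁₃ y₂₃ =
      net-free (induced-copy net (lookup (x₁ ∷ x₂ ∷ x₃ ∷ y₁ ∷ y₂ ∷ y₃ ∷ []))
        (((x₁₂ , λ ()) ∷ (x₁₃ , λ ()) ∷ (x₁y₁ , λ ()) ∷
          (x₁y₂ , λ _ → separated⇒≢ x₁₃ (adj-sym x₃y₂)) ∷
          (x₁y₃ , λ _ → separated⇒≢ x₁₂ (adj-sym x₂y₃)) ∷ []) ∷
         ((x₂₃ , λ ()) ∷ (x₂y₁ , λ _ → separated⇒≢ x₂₃ (adj-sym x₃y₁)) ∷ (x₂y₂ , λ ()) ∷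
          (x₂y₃ , λ _ → separated⇒≢ (adj-sym x₁₂) (adj-sym x₁y₃)) ∷ []) ∷
         ((x₃y₁ , λ _ → separated⇒≢ (adj-sym x₂₃) (adj-sym x₂y₁)) ∷
          (x₃y₂ , λ _ → separated⇒≢ (adj-sym x₁₃) (adj-sym x₁y₂)) ∷ (x₃y₃ , λ ()) ∷ []) ∷
         ((y₁₂ , λ _ → separated⇒≢ (adj-sym x₁y₁) (adj-sym x₁y₂)) ∷
          (y₁₃ , λ _ → separated⇒≢ (adj-sym x₁y₁) (adj-sym x₁y₃)) ∷ []) ∷
         ((y₂₃ , λ _ → separated⇒≢ (adj-sym x₂y₂) (adj-sym x₂y₃)) ∷ []) ∷ [] ∷ []))

    one-triangle-per-edge : ∀ {x y z w} → x ~ y → x ~ z → y ~ z → x ~ w → w ≢ z → w ≁ y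
    one-triangle-per-edge xy xz yz xw w≢z with ~-or-≁ _ _
    ... | inj₂ w≁y = w≁y
    ... | inj₁ w~y with ~-or-≁ _ _
    ...   | inj₁ z~w = ⊥-elim (no-K4 xy xz xw yz (adj-sym w~y) z~w)
    ...   | inj₂ z≁w = ⊥-elim (no-diamond xy xz xw yz (adj-sym w~y) z≁w (w≢z ∘ sym))

    claw-closes : ∀ {x a b c} → x ~ a → x ~ b → x ~ c → a ≁ b → a ≁ c → a ≢ b → a ≢ c → b ≢ c → b ~ c
    claw-closes xa xb xc ab ac a≢b a≢c b≢c with ~-or-≁ _ _
    ... | inj₁ bc = bc
    ... | inj₂ bc = ⊥-elim (no-claw xa xb xc ab ac bc a≢b a≢c b≢c)

    bowtie-neighbours : ∀ {x y z u v} → x ~ y → x ~ z → y ~ z → x ~ u → x ~ v → u ~ v →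
                        u ≢ y → u ≢ z → v ≢ y → v ≢ z →
                        ∀ {w} → x ~ w → w ≡ y ⊎ w ≡ z ⊎ w ≡ u ⊎ w ≡ v
    bowtie-neighbours {x} {y} {z} {u} {v} xy xz yz xu xv uv u≢y u≢z v≢y v≢z {w} xw
      with w ≟ᶠ y | w ≟ᶠ z | w ≟ᶠ u | w ≟ᶠ v
    ... | yes w≡y | _       | _       | _       = inj₁ w≡y
    ... | no _    | yes w≡z | _       | _       = inj₂ (inj₁ w≡z)
    ... | no _    | no _    | yes w≡u | _       = inj₂ (inj₂ (inj₁ w≡u))
    ... | no _    | no _    | no _    | yes w≡v = inj₂ (inj₂ (inj₂ w≡v))
    ... | no w≢y  | no w≢z  | no w≢u  | no w≢v  = ⊥-elim (no-claw xy xu xw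
          (adj-sym (one-triangle-per-edge xy xz yz xu u≢z)) (adj-sym (one-triangle-per-edge xy xz yz xw w≢z))
          (adj-sym (one-triangle-per-edge xu xv uv xw w≢v)) (u≢y ∘ sym) (w≢y ∘ sym) (w≢u ∘ sym))

    not-both : ∀ {x a b w} → x ~ a → x ~ b → a ~ b → w ≢ x → w ≁ a ⊎ w ≁ b
    not-both xa xb ab w≢x with ~-or-≁ _ _
    ... | inj₂ w≁a = inj₁ w≁a
    ... | inj₁ w~a = inj₂ (one-triangle-per-edge ab (adj-sym xa) (adj-sym xb) (adj-sym w~a) w≢x)

    no-net-around : ∀ {x₁ x₂ x₃ y₁ y₂ y₃} → x₁ ~ x₂ → x₁ ~ x₃ → x₂ ~ x₃ →
                    x₁ ~ y₁ → y₁ ≢ x₂ → y₁ ≢ x₃ →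
                    x₂ ~ y₂ → y₂ ≢ x₁ → y₂ ≢ x₃ →
                    x₃ ~ y₃ → y₃ ≢ x₁ → y₃ ≢ x₂ →
                    y₁ ≁ y₂ → y₁ ≁ y₃ → y₂ ≁ y₃ → ⊥
    no-net-around x₁₂ x₁₃ x₂₃ x₁y₁ y₁≢x₂ y₁≢x₃ x₂y₂ y₂≢x₁ y₂≢x₃ x₃y₃ y₃≢x₁ y₃≢x₂ =
      no-net x₁₂ x₁₃ x₂₃ x₁y₁ x₂y₂ x₃y₃
        (adj-sym (one-triangle-per-edge (adj-sym x₁₂) x₂₃ x₁₃ x₂y₂ y₂≢x₃))
        (adj-sym (one-triangle-per-edge (adj-sym x₁₃) (adj-sym x₂₃) x₁₂ x₃y₃ y₃≢x₂))
        (adj-sym (one-triangle-per-edge x₁₂ x₁₃ x₂₃ x₁y₁ y₁≢x₃))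
        (adj-sym (one-triangle-per-edge (adj-sym x₂₃) (adj-sym x₁₃) (adj-sym x₁₂) x₃y₃ y₃≢x₁))
        (adj-sym (one-triangle-per-edge x₁₃ x₁₂ (adj-sym x₂₃) x₁y₁ y₁≢x₂))
        (adj-sym (one-triangle-per-edge x₂₃ (adj-sym x₁₂) (adj-sym x₁₃) x₂y₂ y₂≢x₁))

    module Minimal {S : Subset (size G)} (subsets-colourable : ProperSubsetsColourable S) (degree : Degree≥3 S) where

      record Triangle (x₁ x₂ x₃ : V) : Set where
        field
          x₁∈S : x₁ ∈ S
          x₂∈S : x₂ ∈ S
          x₃∈S : x₃ ∈ S
          x₁₂  : x₁ ~ x₂
          x₁₃  : x₁ ~ x₃
          x₂₃  : x₂ ~ x₃

        nb₁≁₂ : ∀ {u} → x₁ ~ u → u ≢ x₃ → u ≁ x₂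
        nb₁≁₂ x₁u = one-triangle-per-edge x₁₂ x₁₃ x₂₃ x₁u

        nb₁≁₃ : ∀ {u} → x₁ ~ u → u ≢ x₂ → u ≁ x₃
        nb₁≁₃ x₁u = one-triangle-per-edge x₁₃ x₁₂ (adj-sym x₂₃) x₁u

        nb₂≁₁ : ∀ {u} → x₂ ~ u → u ≢ x₃ → u ≁ x₁
        nb₂≁₁ x₂u = one-triangle-per-edge (adj-sym x₁₂) x₂₃ x₁₃ x₂u

        nb₂≁₃ : ∀ {u} → x₂ ~ u → u ≢ x₁ → u ≁ x₃
        nb₂≁₃ x₂u = one-triangle-per-edge x₂₃ (adj-sym x₁₂) (adj-sym x₁₃) x₂u

        nb₃≁₁ : ∀ {u} → x₃ ~ u → u ≢ x₂ → u ≁ x₁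
        nb₃≁₁ x₃u = one-triangle-per-edge (adj-sym x₁₃) (adj-sym x₂₃) x₁₂ x₃u

        nb₃≁₂ : ∀ {u} → x₃ ~ u → u ≢ x₁ → u ≁ x₂
        nb₃≁₂ x₃u = one-triangle-per-edge (adj-sym x₂₃) (adj-sym x₁₃) (adj-sym x₁₂) x₃u

      swap₁₂ : ∀ {x y z} → Triangle x y z → Triangle y x z
      swap₁₂ t = record { x₁∈S = y∈S ; x₂∈S = x∈S ; x₃∈S = z∈S ; x₁₂ = adj-sym xy ; x₁₃ = yz ; x₂₃ = xz }
        where open Triangle t renaming (x₁∈S to x∈S; x₂∈S to y∈S; x₃∈S to z∈S; x₁₂ to xy; x₁₃ to xz; x₂₃ to yz)

      swap₂₃ : ∀ {x y z} → Triangle x y z → Triangle x z y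
      swap₂₃ t = record { x₁∈S = x∈S ; x₂∈S = z∈S ; x₃∈S = y∈S ; x₁₂ = xz ; x₁₃ = xy ; x₂₃ = adj-sym yz }
        where open Triangle t renaming (x₁∈S to x∈S; x₂∈S to y∈S; x₃∈S to z∈S; x₁₂ to xy; x₁₃ to xz; x₂₃ to yz)

      record OuterEdge (x y z : V) : Set where
        field
          p          : V
          p∈S        : p ∈ S
          xp         : x ~ p
          p≢y        : p ≢ y
          p≢z        : p ≢ z
          neighbours : ∀ {w} → w ∈ S → x ~ w → w ≡ y ⊎ w ≡ z ⊎ w ≡ p

      record OuterTriangle (x y z : V) : Set where
        field
          a b        : V
          a∈S        : a ∈ S
          b∈S        : b ∈ S
          xa         : x ~ a
          xb         : x ~ b
          ab         : a ~ b
          a≢y        : a ≢ y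
          a≢z        : a ≢ z
          b≢y        : b ≢ y
          b≢z        : b ≢ z
          neighbours : ∀ {w} → w ∈ S → x ~ w → w ≡ y ⊎ w ≡ z ⊎ w ≡ a ⊎ w ≡ b

      OuterEdge-swap : ∀ {x y z} → OuterEdge x y z → OuterEdge x z y
      OuterEdge-swap e = record
        { p = p ; p∈S = p∈S ; xp = xp ; p≢y = p≢z ; p≢z = p≢y
        ; neighbours = λ w∈S xw → swap-first-two (neighbours w∈S xw) }
        where open OuterEdge e

      OuterTriangle-swap : ∀ {x y z} → OuterTriangle x y z → OuterTriangle x z y
      OuterTriangle-swap o = record
        { a = a ; b = b ; a∈S = a∈S ; b∈S = b∈S ; xa = xa ; xb = xb ; ab = ab
        ; a≢y = a≢z ; a≢z = a≢y ; b≢y = b≢z ; b≢z = b≢y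
        ; neighbours = λ w∈S xw → swap-first-two (neighbours w∈S xw) }
        where open OuterTriangle o

      OuterTriangle-flip : ∀ {x y z} → OuterTriangle x y z → OuterTriangle x y z
      OuterTriangle-flip o = record
        { a = b ; b = a ; a∈S = b∈S ; b∈S = a∈S ; xa = xb ; xb = xa ; ab = adj-sym ab
        ; a≢y = b≢y ; a≢z = b≢z ; b≢y = a≢y ; b≢z = a≢z
        ; neighbours = λ w∈S xw → Sum.map₂ (Sum.map₂ Sum.swap) (neighbours w∈S xw) }
        where open OuterTriangle o

      outer-type : ∀ {x y z} → Triangle x y z → OuterEdge x y z ⊎ OuterTriangle x y z
      outer-type {x} {y} {z} t with degree (Triangle.x₁∈S t) y z
      ... | p , p∈S , xp , p≢y , p≢z
        with any? (λ q → q ∈? S ×-dec (adj G x q ≟ᵇ true) ×-dec ¬? (q ≟ᶠ y) ×-dec ¬? (q ≟ᶠ z) ×-dec ¬? (q ≟ᶠ p))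
      ... | yes (q , q∈S , xq , q≢y , q≢z , q≢p) = inj₂ record
        { a = p ; b = q ; a∈S = p∈S ; b∈S = q∈S ; xa = xp ; xb = xq ; ab = pq
        ; a≢y = p≢y ; a≢z = p≢z ; b≢y = q≢y ; b≢z = q≢z
        ; neighbours = λ _ → bowtie-neighbours x₁₂ x₁₃ x₂₃ xp xq pq p≢y p≢z q≢y q≢z }
        where
          open Triangle t
          pq : p ~ q
          pq = claw-closes x₁₂ xp xq (adj-sym (nb₁≁₂ xp p≢z)) (adj-sym (nb₁≁₂ xq q≢z))
                           (p≢y ∘ sym) (q≢y ∘ sym) (q≢p ∘ sym)
      ... | no none = inj₁ record
        { p = p ; p∈S = p∈S ; xp = xp ; p≢y = p≢y ; p≢z = p≢z ; neighbours = neighbours }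
        where
          neighbours : ∀ {w} → w ∈ S → x ~ w → w ≡ y ⊎ w ≡ z ⊎ w ≡ p
          neighbours {w} w∈S xw with w ≟ᶠ y | w ≟ᶠ z | w ≟ᶠ p
          ... | yes w≡y | _       | _       = inj₁ w≡y
          ... | no _    | yes w≡z | _       = inj₂ (inj₁ w≡z)
          ... | no _    | no _    | yes w≡p = inj₂ (inj₂ w≡p)
          ... | no w≢y  | no w≢z  | no w≢p  = ⊥-elim (none (w , w∈S , xw , w≢y , w≢z , w≢p))

      record OtherTriangle (p x u : V) : Set where
        field
          s          : V
          s∈S        : s ∈ S
          ps         : p ~ s
          us         : u ~ s
          s≢x        : s ≢ x
          s≢u        : s ≢ u
          neighbours : ∀ {w} → w ∈ S → p ~ w → w ≡ u ⊎ w ≡ s ⊎ w ≡ x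

      module _ {x y z} (t : Triangle x y z) (e : OuterEdge x y z) where
        open Triangle t
        open OuterEdge e hiding (neighbours)

        outer-edge-≁ : ∀ {w} → w ∈ S → p ~ w → w ≢ x → x ≁ w
        outer-edge-≁ {w} w∈S pw w≢x with ~-or-≁ x w
        ... | inj₂ x≁w = x≁w
        ... | inj₁ xw with OuterEdge.neighbours e w∈S xw
        ...   | inj₁ refl        = ⊥-elim (~∧≁⇒⊥ pw (nb₁≁₂ xp p≢z))
        ...   | inj₂ (inj₁ refl) = ⊥-elim (~∧≁⇒⊥ pw (nb₁≁₃ xp p≢y))
        ...   | inj₂ (inj₂ refl) = ⊥-elim (~⇒≢ pw refl)

        other-triangle : ∀ {u} → u ∈ S → p ~ u → u ≢ x → OtherTriangle p x u
        other-triangle {u} u∈S pu u≢x with degree p∈S x u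
        ... | s , s∈S , ps , s≢x , s≢u = record
          { s = s ; s∈S = s∈S ; ps = ps ; us = us ; s≢x = s≢x ; s≢u = s≢u ; neighbours = neighbours }
          where
            us : u ~ s
            us = claw-closes (adj-sym xp) pu ps (outer-edge-≁ u∈S pu u≢x) (outer-edge-≁ s∈S ps s≢x)
                             (u≢x ∘ sym) (s≢x ∘ sym) (s≢u ∘ sym)

            neighbours : ∀ {w} → w ∈ S → p ~ w → w ≡ u ⊎ w ≡ s ⊎ w ≡ x
            neighbours {w} w∈S pw with w ≟ᶠ u | w ≟ᶠ s | w ≟ᶠ x
            ... | yes w≡u | _       | _       = inj₁ w≡u
            ... | no _    | yes w≡s | _       = inj₂ (inj₁ w≡s)
            ... | no _    | no _    | yes w≡x = inj₂ (inj₂ w≡x)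
            ... | no w≢u  | no w≢s  | no w≢x  = ⊥-elim (no-claw (adj-sym xp) pu pw
                  (outer-edge-≁ u∈S pu u≢x) (outer-edge-≁ w∈S pw w≢x)
                  (adj-sym (one-triangle-per-edge pu ps us pw w≢s)) (u≢x ∘ sym) (w≢x ∘ sym) (w≢u ∘ sym))

      reduce-C4 : ∀ {x₁ x₂ x₃} (t : Triangle x₁ x₂ x₃) (e₁ : OuterEdge x₁ x₂ x₃) (e₂ : OuterEdge x₂ x₁ x₃) →
                  OuterEdge.p e₁ ~ OuterEdge.p e₂ → ColourableOn S
      reduce-C4 {x₁} {x₂} {x₃} t e₁ e₂ p₁p₂ = reduce C4-configuration C4-extendable (# 0) placement subsets-colourable
        where
          open Triangle t
          module E₁ = OuterEdge e₁
          module E₂ = OuterEdge e₂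
          module O₁ = OtherTriangle (other-triangle t e₁ E₂.p∈S p₁p₂ E₂.p≢y)
          module O₂ = OtherTriangle (other-triangle (swap₁₂ t) e₂ E₁.p∈S (adj-sym p₁p₂) E₁.p≢y)

          placement : Placement C4-configuration S
          placement = record
            { inners        = x₁ ∷ x₂ ∷ E₂.p ∷ E₁.p ∷ []
            ; outers        = x₃ ∷ O₂.s ∷ O₁.s ∷ []
            ; inners∈S      = x₁∈S ∷ x₂∈S ∷ E₂.p∈S ∷ E₁.p∈S ∷ []
            ; outers∈S      = x₃∈S ∷ O₂.s∈S ∷ O₁.s∈S ∷ []
            ; inners-unique =
                (~⇒≢ x₁₂ ∷ E₂.p≢y ∘ sym ∷ ~⇒≢ E₁.xp ∷ []) ∷
                (~⇒≢ E₂.xp ∷ E₁.p≢y ∘ sym ∷ []) ∷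
                (~⇒≢ (adj-sym p₁p₂) ∷ []) ∷ [] ∷ []
            ; outers∉inners =
                (~⇒≢ (adj-sym x₁₃) ∷ ~⇒≢ (adj-sym x₂₃) ∷ E₂.p≢z ∘ sym ∷ E₁.p≢z ∘ sym ∷ []) ∷
                (separated⇒≢ (adj-sym O₂.ps) (adj-sym (nb₂≁₁ E₂.xp E₂.p≢z)) ∷ O₂.s≢x ∷
                 ~⇒≢ (adj-sym O₂.ps) ∷ O₂.s≢u ∷ []) ∷
                (O₁.s≢x ∷ separated⇒≢ (adj-sym O₁.ps) (adj-sym (nb₁≁₂ E₁.xp E₁.p≢z)) ∷
                 O₁.s≢u ∷ ~⇒≢ (adj-sym O₁.ps) ∷ []) ∷ []
            ; outer-edges   = []
            ; closed        = closed
            }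
            where
              closed : Closed C4-configuration S (x₁ ∷ x₂ ∷ E₂.p ∷ E₁.p ∷ []) (x₃ ∷ O₂.s ∷ O₁.s ∷ [])
              closed zero w∈S x₁w with E₁.neighbours w∈S x₁w
              ... | inj₁ refl        = inj₁ (# 1 , refl , refl)
              ... | inj₂ (inj₁ refl) = inj₂ (# 0 , refl , refl)
              ... | inj₂ (inj₂ refl) = inj₁ (# 3 , refl , refl)
              closed (suc zero) w∈S x₂w with E₂.neighbours w∈S x₂w
              ... | inj₁ refl        = inj₁ (# 0 , refl , refl)
              ... | inj₂ (inj₁ refl) = inj₂ (# 0 , refl , refl)
              ... | inj₂ (inj₂ refl) = inj₁ (# 2 , refl , refl)
              closed (suc (suc zero)) w∈S p₂w with O₂.neighbours w∈S p₂w
              ... | inj₁ refl        = inj₁ (# 3 , refl , refl)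
              ... | inj₂ (inj₁ refl) = inj₂ (# 1 , refl , refl)
              ... | inj₂ (inj₂ refl) = inj₁ (# 1 , refl , refl)
              closed (suc (suc (suc zero))) w∈S p₁w with O₁.neighbours w∈S p₁w
              ... | inj₁ refl        = inj₁ (# 2 , refl , refl)
              ... | inj₂ (inj₁ refl) = inj₂ (# 2 , refl , refl)
              ... | inj₂ (inj₂ refl) = inj₁ (# 0 , refl , refl)

      three-outer-edges : ∀ {x₁ x₂ x₃} → Triangle x₁ x₂ x₃ →
                          OuterEdge x₁ x₂ x₃ → OuterEdge x₂ x₁ x₃ → OuterEdge x₃ x₁ x₂ → ColourableOn S
      three-outer-edges t e₁ e₂ e₃
        with ~-or-≁ (OuterEdge.p e₁) (OuterEdge.p e₂) | ~-or-≁ (OuterEdge.p e₁) (OuterEdge.p e₃)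
           | ~-or-≁ (OuterEdge.p e₂) (OuterEdge.p e₃)
      ... | inj₁ p₁p₂ | _         | _         = reduce-C4 t e₁ e₂ p₁p₂
      ... | inj₂ _    | inj₁ p₁p₃ | _         = reduce-C4 (swap₂₃ t) (OuterEdge-swap e₁) e₃ p₁p₃
      ... | inj₂ _    | inj₂ _    | inj₁ p₂p₃ =
        reduce-C4 (swap₂₃ (swap₁₂ t)) (OuterEdge-swap e₂) (OuterEdge-swap e₃) p₂p₃
      ... | inj₂ p₁p₂ | inj₂ p₁p₃ | inj₂ p₂p₃ = ⊥-elim (no-net-around x₁₂ x₁₃ x₂₃
          E₁.xp E₁.p≢y E₁.p≢z E₂.xp E₂.p≢y E₂.p≢z E₃.xp E₃.p≢y E₃.p≢z p₁p₂ p₁p₃ p₂p₃)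
        where
          open Triangle t
          module E₁ = OuterEdge e₁
          module E₂ = OuterEdge e₂
          module E₃ = OuterEdge e₃

      module _ {x₁ x₂ x₃} (t : Triangle x₁ x₂ x₃)
               (o₂ : OuterTriangle x₂ x₁ x₃) (o₃ : OuterTriangle x₃ x₁ x₂) where
        open Triangle t
        private
          module O₂ = OuterTriangle o₂
          module O₃ = OuterTriangle o₃

          avoided-pair-gives-net : ∀ {u c} → x₁ ~ u → u ≢ x₂ → u ≢ x₃ → u ≁ O₂.a → u ≁ O₂.b →
                                   x₃ ~ c → c ≢ x₁ → c ≢ x₂ → u ≁ c → ⊥
          avoided-pair-gives-net x₁u u≢x₂ u≢x₃ ua₂ ub₂ x₃c c≢x₁ c≢x₂ uc with not-both O₂.xa O₂.xb O₂.ab c≢x₂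
          ... | inj₁ ca₂ = no-net-around x₁₂ x₁₃ x₂₃ x₁u u≢x₂ u≢x₃ O₂.xa O₂.a≢y O₂.a≢z x₃c c≢x₁ c≢x₂
                             ua₂ uc (adj-sym ca₂)
          ... | inj₂ cb₂ = no-net-around x₁₂ x₁₃ x₂₃ x₁u u≢x₂ u≢x₃ O₂.xb O₂.b≢y O₂.b≢z x₃c c≢x₁ c≢x₂
                             ub₂ uc (adj-sym cb₂)

        outer-neighbour-meets : ∀ {u} → x₁ ~ u → u ≢ x₂ → u ≢ x₃ → u ~ O₂.a ⊎ u ~ O₂.b
        outer-neighbour-meets {u} x₁u u≢x₂ u≢x₃ with ~-or-≁ u O₂.a | ~-or-≁ u O₂.b
        ... | inj₁ ua₂ | _        = inj₁ ua₂
        ... | inj₂ _   | inj₁ ub₂ = inj₂ ub₂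
        ... | inj₂ ua₂ | inj₂ ub₂ with not-both O₃.xa O₃.xb O₃.ab u≢x₃
        ...   | inj₁ ua₃ = ⊥-elim (avoided-pair-gives-net x₁u u≢x₂ u≢x₃ ua₂ ub₂ O₃.xa O₃.a≢y O₃.a≢z ua₃)
        ...   | inj₂ ub₃ = ⊥-elim (avoided-pair-gives-net x₁u u≢x₂ u≢x₃ ua₂ ub₂ O₃.xb O₃.b≢y O₃.b≢z ub₃)

      module _ {x₁ x₂ x₃} (t : Triangle x₁ x₂ x₃) (e₁ : OuterEdge x₁ x₂ x₃) (e₂ : OuterEdge x₂ x₁ x₃) where
        open Triangle t
        private
          module E₁ = OuterEdge e₁
          module E₂ = OuterEdge e₂

          other-end-≁ : ∀ (o : OuterTriangle x₃ x₁ x₂) {p} → OuterTriangle.a o ~ p → p ≢ x₃ → OuterTriangle.b o ≁ p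
          other-end-≁ o ap p≢x₃ = adj-sym (one-triangle-per-edge O.ab (adj-sym O.xa) (adj-sym O.xb) ap p≢x₃)
            where module O = OuterTriangle o

          net-through : ∀ {c} → x₃ ~ c → c ≢ x₁ → c ≢ x₂ → E₁.p ≁ E₂.p → c ≁ E₁.p → c ≁ E₂.p → ⊥
          net-through x₃c c≢x₁ c≢x₂ p₁p₂ cp₁ cp₂ = no-net-around x₁₂ x₁₃ x₂₃
            E₁.xp E₁.p≢y E₁.p≢z E₂.xp E₂.p≢y E₂.p≢z x₃c c≢x₁ c≢x₂ p₁p₂ (adj-sym cp₁) (adj-sym cp₂)

        -- The net: triangle x₃ a b with pendants x₁, the third neighbour s of p₁, and p₂.
        outer-edges-unmatched : (o : OuterTriangle x₃ x₁ x₂) → OuterTriangle.a o ~ E₁.p → OuterTriangle.b o ~ E₂.p →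
                                E₁.p ≁ E₂.p → OuterTriangle.b o ≁ E₁.p → ⊥
        outer-edges-unmatched o ap₁ bp₂ p₁p₂ bp₁ =
          no-net-around O.xa O.xb O.ab
            (adj-sym x₁₃) (O.a≢y ∘ sym) (O.b≢y ∘ sym)
            O₁.us s≢x₃ s≢b
            bp₂ E₂.p≢z (separated⇒≢ (adj-sym E₂.xp) (nb₃≁₂ O.xa O.a≢y))
            x₁≁s (adj-sym (nb₂≁₁ E₂.xp E₂.p≢z)) s≁p₂
          where
            module O = OuterTriangle o
            module O₁ = OtherTriangle (other-triangle t e₁ O.a∈S (adj-sym ap₁) O.a≢y)
            s≢x₃ : O₁.s ≢ x₃
            s≢x₃ = separated⇒≢ (adj-sym O₁.ps) (adj-sym (nb₁≁₃ E₁.xp E₁.p≢y))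
            s≢b : O₁.s ≢ O.b
            s≢b = separated⇒≢ (adj-sym O₁.ps) bp₁
            x₁≁s : x₁ ≁ O₁.s
            x₁≁s = outer-edge-≁ t e₁ O₁.s∈S O₁.ps O₁.s≢x
            s≁p₂ : O₁.s ≁ E₂.p
            s≁p₂ with ~-or-≁ O₁.s E₂.p
            ... | inj₂ s≁p₂ = s≁p₂
            ... | inj₁ s~p₂ = ⊥-elim (no-claw (adj-sym E₂.xp) (adj-sym bp₂) (adj-sym s~p₂)
                  (adj-sym (nb₃≁₂ O.xb O.b≢y))
                  (outer-edge-≁ (swap₁₂ t) e₂ O₁.s∈S (adj-sym s~p₂) s≢x₂)
                  (adj-sym (one-triangle-per-edge O.ab (adj-sym O.xa) (adj-sym O.xb) O₁.us s≢x₃))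
                  (O.b≢z ∘ sym) (s≢x₂ ∘ sym) (s≢b ∘ sym))
              where
                s≢x₂ : O₁.s ≢ x₂
                s≢x₂ = separated⇒≢ (adj-sym O₁.ps) (adj-sym (nb₁≁₂ E₁.xp E₁.p≢z))

        module _ (o : OuterTriangle x₃ x₁ x₂) where
          private
            module O = OuterTriangle o

          outer-edges-adjacent : E₁.p ~ E₂.p
          outer-edges-adjacent with ~-or-≁ E₁.p E₂.p | ~-or-≁ O.a E₁.p | ~-or-≁ O.a E₂.p
          ... | inj₁ p₁p₂ | _        | _ = p₁p₂
          ... | inj₂ p₁p₂ | inj₁ ap₁ | _ with ~-or-≁ O.b E₂.p
          ...   | inj₁ bp₂ = ⊥-elim (outer-edges-unmatched o ap₁ bp₂ p₁p₂ (other-end-≁ o ap₁ E₁.p≢z))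
          ...   | inj₂ bp₂ = ⊥-elim (net-through O.xb O.b≢y O.b≢z p₁p₂ (other-end-≁ o ap₁ E₁.p≢z) bp₂)
          outer-edges-adjacent | inj₂ p₁p₂ | inj₂ ap₁ | inj₁ ap₂ with ~-or-≁ O.b E₁.p
          ...   | inj₁ bp₁ = ⊥-elim (outer-edges-unmatched (OuterTriangle-flip o) bp₁ ap₂ p₁p₂ ap₁)
          ...   | inj₂ bp₁ = ⊥-elim (net-through O.xb O.b≢y O.b≢z p₁p₂ bp₁ (other-end-≁ o ap₂ E₂.p≢z))
          outer-edges-adjacent | inj₂ p₁p₂ | inj₂ ap₁ | inj₂ ap₂ =
            ⊥-elim (net-through O.xa O.a≢y O.a≢z p₁p₂ ap₁ ap₂)

        two-outer-edges : OuterTriangle x₃ x₁ x₂ → ColourableOn S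
        two-outer-edges o = reduce-C4 t e₁ e₂ (outer-edges-adjacent o)

      reduce-K1 : ∀ {x₁ x₂ x₃} → Triangle x₁ x₂ x₃ → (e : OuterEdge x₁ x₂ x₃) →
                  (o₂ : OuterTriangle x₂ x₁ x₃) (o₃ : OuterTriangle x₃ x₁ x₂) →
                  OuterEdge.p e ~ OuterTriangle.a o₂ → OuterEdge.p e ~ OuterTriangle.a o₃ → ColourableOn S
      reduce-K1 {x₁} {x₂} {x₃} t e o₂ o₃ pa₂ pa₃ = reduce K1-configuration K1-extendable (# 0) placement subsets-colourable
        where
          open Triangle t
          module E = OuterEdge e
          module O₂ = OuterTriangle o₂
          module O₃ = OuterTriangle o₃

          b₂≁x₃ : O₂.b ≁ x₃
          b₂≁x₃ = nb₂≁₃ O₂.xb O₂.b≢y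

          p≁b₂ : E.p ≁ O₂.b
          p≁b₂ = one-triangle-per-edge O₂.ab (adj-sym O₂.xa) (adj-sym O₂.xb) (adj-sym pa₂) E.p≢y

          a₂a₃ : O₂.a ~ O₃.a
          a₂a₃ = claw-closes (adj-sym E.xp) pa₂ pa₃
            (adj-sym (nb₂≁₁ O₂.xa O₂.a≢z)) (adj-sym (nb₃≁₁ O₃.xa O₃.a≢z))
            (O₂.a≢y ∘ sym) (O₃.a≢y ∘ sym) (separated⇒≢ (adj-sym O₂.xa) (nb₃≁₂ O₃.xa O₃.a≢y))

          -- Take a third neighbour z of b₂.  If a₃ ≁ z, the triangle x₂a₂b₂ with pendants x₁, a₃, z
          -- is a net; otherwise z lies in the bowtie a₃x₃b₃ / a₃pa₂, which forces z = b₃.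
          b₂b₃ : O₂.b ~ O₃.b
          b₂b₃ with degree O₂.b∈S x₂ O₂.a
          ... | z , z∈S , b₂z , z≢x₂ , z≢a₂ with ~-or-≁ O₃.a z
          ...   | inj₁ a₃z with bowtie-neighbours (adj-sym O₃.xa) O₃.ab O₃.xb (adj-sym pa₃) (adj-sym a₂a₃) pa₂
                     E.p≢z (separated⇒≢ (adj-sym E.xp) (nb₃≁₁ O₃.xb O₃.b≢z))
                     O₂.a≢z (separated⇒≢ (adj-sym O₂.xa) (nb₃≁₂ O₃.xb O₃.b≢y)) a₃z
          ...     | inj₁ refl               = ⊥-elim (~∧≁⇒⊥ b₂z b₂≁x₃)
          ...     | inj₂ (inj₁ refl)        = b₂z
          ...     | inj₂ (inj₂ (inj₁ refl)) = ⊥-elim (~∧≁⇒⊥ b₂z (adj-sym p≁b₂))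
          ...     | inj₂ (inj₂ (inj₂ refl)) = ⊥-elim (z≢a₂ refl)
          b₂b₃ | z , z∈S , b₂z , z≢x₂ , z≢a₂ | inj₂ a₃z = ⊥-elim (no-net-around O₂.xa O₂.xb O₂.ab
            (adj-sym x₁₂) (O₂.a≢y ∘ sym) (O₂.b≢y ∘ sym)
            a₂a₃ O₃.a≢z (separated⇒≢ (adj-sym O₃.xa) b₂≁x₃)
            b₂z z≢x₂ z≢a₂
            (adj-sym (nb₃≁₁ O₃.xa O₃.a≢z)) x₁≁z a₃z)
            where
              x₁≁z : x₁ ≁ z
              x₁≁z with ~-or-≁ x₁ z
              ... | inj₂ x₁≁z = x₁≁z
              ... | inj₁ x₁z with E.neighbours z∈S x₁z
              ...   | inj₁ refl        = ⊥-elim (z≢x₂ refl)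
              ...   | inj₂ (inj₁ refl) = ⊥-elim (~∧≁⇒⊥ b₂z b₂≁x₃)
              ...   | inj₂ (inj₂ refl) = ⊥-elim (~∧≁⇒⊥ b₂z (adj-sym p≁b₂))

          placement : Placement K1-configuration S
          placement = record
            { inners        = x₁ ∷ []
            ; outers        = x₂ ∷ x₃ ∷ E.p ∷ O₂.a ∷ O₂.b ∷ O₃.a ∷ O₃.b ∷ []
            ; inners∈S      = x₁∈S ∷ []
            ; outers∈S      = x₂∈S ∷ x₃∈S ∷ E.p∈S ∷ O₂.a∈S ∷ O₂.b∈S ∷ O₃.a∈S ∷ O₃.b∈S ∷ []
            ; inners-unique = [] ∷ []
            ; outers∉inners =
                ((~⇒≢ x₁₂ ∘ sym) ∷ []) ∷ ((~⇒≢ x₁₃ ∘ sym) ∷ []) ∷ ((~⇒≢ E.xp ∘ sym) ∷ []) ∷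
                (O₂.a≢y ∷ []) ∷ (O₂.b≢y ∷ []) ∷ (O₃.a≢y ∷ []) ∷ (O₃.b≢y ∷ []) ∷ []
            ; outer-edges   = O₂.xa ∷ O₂.xb ∷ O₂.ab ∷ O₃.xa ∷ O₃.xb ∷ O₃.ab ∷ pa₂ ∷ pa₃ ∷ b₂b₃ ∷ []
            ; closed        = closed
            }
            where
              closed : Closed K1-configuration S (x₁ ∷ []) (x₂ ∷ x₃ ∷ E.p ∷ O₂.a ∷ O₂.b ∷ O₃.a ∷ O₃.b ∷ [])
              closed zero w∈S x₁w with E.neighbours w∈S x₁w
              ... | inj₁ refl        = inj₂ (# 0 , refl , refl)
              ... | inj₂ (inj₁ refl) = inj₂ (# 1 , refl , refl)
              ... | inj₂ (inj₂ refl) = inj₂ (# 2 , refl , refl)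

      reduce-K3 : ∀ {x₁ x₂ x₃} → Triangle x₁ x₂ x₃ → (o₁ : OuterTriangle x₁ x₂ x₃) →
                  (o₂ : OuterTriangle x₂ x₁ x₃) (o₃ : OuterTriangle x₃ x₁ x₂) →
                  OuterTriangle.a o₁ ~ OuterTriangle.a o₂ → OuterTriangle.a o₁ ~ OuterTriangle.a o₃ → ColourableOn S
      reduce-K3 {x₁} {x₂} {x₃} t o₁ o₂ o₃ a₁a₂ a₁a₃ = reduce K3-configuration K3-extendable (# 0) placement subsets-colourable
        where
          open Triangle t
          module O₁ = OuterTriangle o₁
          module O₂ = OuterTriangle o₂
          module O₃ = OuterTriangle o₃

          a₂a₃ : O₂.a ~ O₃.a
          a₂a₃ = claw-closes (adj-sym O₁.xa) a₁a₂ a₁a₃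
            (adj-sym (nb₂≁₁ O₂.xa O₂.a≢z)) (adj-sym (nb₃≁₁ O₃.xa O₃.a≢z))
            (O₂.a≢y ∘ sym) (O₃.a≢y ∘ sym) (separated⇒≢ (adj-sym O₂.xa) (nb₃≁₂ O₃.xa O₃.a≢y))

          b₁-meets-b : ∀ {a b} → O₁.a ~ a → O₁.b ~ a ⊎ O₁.b ~ b → a ≢ x₁ → O₁.b ~ b
          b₁-meets-b _ (inj₂ b₁b) _ = b₁b
          b₁-meets-b a₁a (inj₁ b₁a) a≢x₁ with not-both O₁.xa O₁.xb O₁.ab a≢x₁
          ... | inj₁ a≁a₁ = ⊥-elim (~∧≁⇒⊥ (adj-sym a₁a) a≁a₁)
          ... | inj₂ a≁b₁ = ⊥-elim (~∧≁⇒⊥ (adj-sym b₁a) a≁b₁)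

          b₁b₂ : O₁.b ~ O₂.b
          b₁b₂ = b₁-meets-b a₁a₂ (outer-neighbour-meets t o₂ o₃ O₁.xb O₁.b≢y O₁.b≢z) O₂.a≢y

          b₁b₃ : O₁.b ~ O₃.b
          b₁b₃ = b₁-meets-b a₁a₃ (outer-neighbour-meets (swap₂₃ t) o₃ o₂ O₁.xb O₁.b≢z O₁.b≢y) O₃.a≢y

          b₂b₃ : O₂.b ~ O₃.b
          b₂b₃ = claw-closes (adj-sym O₁.xb) b₁b₂ b₁b₃
            (adj-sym (nb₂≁₁ O₂.xb O₂.b≢z)) (adj-sym (nb₃≁₁ O₃.xb O₃.b≢z))
            (O₂.b≢y ∘ sym) (O₃.b≢y ∘ sym) (separated⇒≢ (adj-sym O₂.xb) (nb₃≁₂ O₃.xb O₃.b≢y))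

          placement : Placement K3-configuration S
          placement = record
            { inners        = x₁ ∷ x₂ ∷ x₃ ∷ []
            ; outers        = O₁.a ∷ O₁.b ∷ O₂.a ∷ O₂.b ∷ O₃.a ∷ O₃.b ∷ []
            ; inners∈S      = x₁∈S ∷ x₂∈S ∷ x₃∈S ∷ []
            ; outers∈S      = O₁.a∈S ∷ O₁.b∈S ∷ O₂.a∈S ∷ O₂.b∈S ∷ O₃.a∈S ∷ O₃.b∈S ∷ []
            ; inners-unique = (~⇒≢ x₁₂ ∷ ~⇒≢ x₁₃ ∷ []) ∷ (~⇒≢ x₂₃ ∷ []) ∷ [] ∷ []
            ; outers∉inners =
                (~⇒≢ O₁.xa ∘ sym ∷ O₁.a≢y ∷ O₁.a≢z ∷ []) ∷ (~⇒≢ O₁.xb ∘ sym ∷ O₁.b≢y ∷ O₁.b≢z ∷ []) ∷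
                (O₂.a≢y ∷ ~⇒≢ O₂.xa ∘ sym ∷ O₂.a≢z ∷ []) ∷ (O₂.b≢y ∷ ~⇒≢ O₂.xb ∘ sym ∷ O₂.b≢z ∷ []) ∷
                (O₃.a≢y ∷ O₃.a≢z ∷ ~⇒≢ O₃.xa ∘ sym ∷ []) ∷ (O₃.b≢y ∷ O₃.b≢z ∷ ~⇒≢ O₃.xb ∘ sym ∷ []) ∷ []
            ; outer-edges   = O₁.ab ∷ O₂.ab ∷ O₃.ab ∷ a₁a₂ ∷ a₂a₃ ∷ a₁a₃ ∷ b₁b₂ ∷ b₂b₃ ∷ b₁b₃ ∷ []
            ; closed        = closed
            }
            where
              closed : Closed K3-configuration S (x₁ ∷ x₂ ∷ x₃ ∷ []) (O₁.a ∷ O₁.b ∷ O₂.a ∷ O₂.b ∷ O₃.a ∷ O₃.b ∷ [])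
              closed zero w∈S x₁w with O₁.neighbours w∈S x₁w
              ... | inj₁ refl               = inj₁ (# 1 , refl , refl)
              ... | inj₂ (inj₁ refl)        = inj₁ (# 2 , refl , refl)
              ... | inj₂ (inj₂ (inj₁ refl)) = inj₂ (# 0 , refl , refl)
              ... | inj₂ (inj₂ (inj₂ refl)) = inj₂ (# 1 , refl , refl)
              closed (suc zero) w∈S x₂w with O₂.neighbours w∈S x₂w
              ... | inj₁ refl               = inj₁ (# 0 , refl , refl)
              ... | inj₂ (inj₁ refl)        = inj₁ (# 2 , refl , refl)
              ... | inj₂ (inj₂ (inj₁ refl)) = inj₂ (# 2 , refl , refl)
              ... | inj₂ (inj₂ (inj₂ refl)) = inj₂ (# 3 , refl , refl)
              closed (suc (suc zero)) w∈S x₃w with O₃.neighbours w∈S x₃w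
              ... | inj₁ refl               = inj₁ (# 0 , refl , refl)
              ... | inj₂ (inj₁ refl)        = inj₁ (# 1 , refl , refl)
              ... | inj₂ (inj₂ (inj₁ refl)) = inj₂ (# 4 , refl , refl)
              ... | inj₂ (inj₂ (inj₂ refl)) = inj₂ (# 5 , refl , refl)

      one-outer-edge : ∀ {x₁ x₂ x₃} → Triangle x₁ x₂ x₃ → OuterEdge x₁ x₂ x₃ →
                       OuterTriangle x₂ x₁ x₃ → OuterTriangle x₃ x₁ x₂ → ColourableOn S
      one-outer-edge t e o₂ o₃
        with outer-neighbour-meets t o₂ o₃ (OuterEdge.xp e) (OuterEdge.p≢y e) (OuterEdge.p≢z e)
           | outer-neighbour-meets (swap₂₃ t) o₃ o₂ (OuterEdge.xp e) (OuterEdge.p≢z e) (OuterEdge.p≢y e)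
      ... | inj₁ pa₂ | inj₁ pa₃ = reduce-K1 t e o₂ o₃ pa₂ pa₃
      ... | inj₁ pa₂ | inj₂ pb₃ = reduce-K1 t e o₂ (OuterTriangle-flip o₃) pa₂ pb₃
      ... | inj₂ pb₂ | inj₁ pa₃ = reduce-K1 t e (OuterTriangle-flip o₂) o₃ pb₂ pa₃
      ... | inj₂ pb₂ | inj₂ pb₃ = reduce-K1 t e (OuterTriangle-flip o₂) (OuterTriangle-flip o₃) pb₂ pb₃

      three-outer-triangles : ∀ {x₁ x₂ x₃} → Triangle x₁ x₂ x₃ → OuterTriangle x₁ x₂ x₃ →
                              OuterTriangle x₂ x₁ x₃ → OuterTriangle x₃ x₁ x₂ → ColourableOn S
      three-outer-triangles t o₁ o₂ o₃
        with outer-neighbour-meets t o₂ o₃ (OuterTriangle.xa o₁) (OuterTriangle.a≢y o₁) (OuterTriangle.a≢z o₁)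
           | outer-neighbour-meets (swap₂₃ t) o₃ o₂ (OuterTriangle.xa o₁) (OuterTriangle.a≢z o₁) (OuterTriangle.a≢y o₁)
      ... | inj₁ a₁a₂ | inj₁ a₁a₃ = reduce-K3 t o₁ o₂ o₃ a₁a₂ a₁a₃
      ... | inj₁ a₁a₂ | inj₂ a₁b₃ = reduce-K3 t o₁ o₂ (OuterTriangle-flip o₃) a₁a₂ a₁b₃
      ... | inj₂ a₁b₂ | inj₁ a₁a₃ = reduce-K3 t o₁ (OuterTriangle-flip o₂) o₃ a₁b₂ a₁a₃
      ... | inj₂ a₁b₂ | inj₂ a₁b₃ = reduce-K3 t o₁ (OuterTriangle-flip o₂) (OuterTriangle-flip o₃) a₁b₂ a₁b₃

      colourable-around : ∀ {x₁ x₂ x₃} → Triangle x₁ x₂ x₃ → ColourableOn S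
      colourable-around t with outer-type t | outer-type (swap₁₂ t) | outer-type (swap₁₂ (swap₂₃ t))
      ... | inj₁ e₁ | inj₁ e₂ | inj₁ e₃ = three-outer-edges t e₁ e₂ e₃
      ... | inj₁ e₁ | inj₁ e₂ | inj₂ o₃ = two-outer-edges t e₁ e₂ o₃
      ... | inj₁ e₁ | inj₂ o₂ | inj₁ e₃ = two-outer-edges (swap₂₃ t) (OuterEdge-swap e₁) e₃ o₂
      ... | inj₂ o₁ | inj₁ e₂ | inj₁ e₃ =
        two-outer-edges (swap₂₃ (swap₁₂ t)) (OuterEdge-swap e₂) (OuterEdge-swap e₃) o₁
      ... | inj₁ e₁ | inj₂ o₂ | inj₂ o₃ = one-outer-edge t e₁ o₂ o₃
      ... | inj₂ o₁ | inj₁ e₂ | inj₂ o₃ = one-outer-edge (swap₁₂ t) e₂ o₁ (OuterTriangle-swap o₃)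
      ... | inj₂ o₁ | inj₂ o₂ | inj₁ e₃ =
        one-outer-edge (swap₁₂ (swap₂₃ t)) e₃ (OuterTriangle-swap o₁) (OuterTriangle-swap o₂)
      ... | inj₂ o₁ | inj₂ o₂ | inj₂ o₃ = three-outer-triangles t o₁ o₂ o₃

      colourable-from : ∀ {v} → v ∈ S → ColourableOn S
      colourable-from {v} v∈S with degree v∈S v v
      ... | a , a∈S , va , _ , _ with degree v∈S a a
      ... | b , b∈S , vb , b≢a , _ with degree v∈S a b
      ... | c , c∈S , vc , c≢a , c≢b with ~-or-≁ a b | ~-or-≁ a c | ~-or-≁ b c
      ... | inj₁ ab | _ | _ = colourable-around (record
        { x₁∈S = v∈S ; x₂∈S = a∈S ; x₃∈S = b∈S ; x₁₂ = va ; x₁₃ = vb ; x₂₃ = ab })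
      ... | inj₂ _ | inj₁ ac | _ = colourable-around (record
        { x₁∈S = v∈S ; x₂∈S = a∈S ; x₃∈S = c∈S ; x₁₂ = va ; x₁₃ = vc ; x₂₃ = ac })
      ... | inj₂ _ | inj₂ _ | inj₁ bc = colourable-around (record
        { x₁∈S = v∈S ; x₂∈S = b∈S ; x₃∈S = c∈S ; x₁₂ = vb ; x₁₃ = vc ; x₂₃ = bc })
      ... | inj₂ ab | inj₂ ac | inj₂ bc =
        ⊥-elim (no-claw va vb vc ab ac bc (b≢a ∘ sym) (c≢a ∘ sym) (c≢b ∘ sym))

    colourable-on : ∀ S → ColourableOn S
    colourable-on = All.wfRec ⊂-wellFounded _ ColourableOn colourable-if-proper-subsets-are
      where
        colourable-if-proper-subsets-are : ∀ S → ProperSubsetsColourable S → ColourableOn S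
        colourable-if-proper-subsets-are S subsets-colourable with any? (_∈? S)
        ... | no empty = (λ _ → zero) , λ u∈S _ _ → ⊥-elim (empty (_ , u∈S))
        ... | yes (v , v∈S) with low-vertex? S
        ...   | yes (u , u∈S , _ , _ , low) = low-vertex-removable subsets-colourable u∈S low
        ...   | no none = Minimal.colourable-from subsets-colourable (no-low-vertex⇒degree≥3 none) v∈S

    three-colourable : Colorable 3 G
    three-colourable = proj₁ (colourable-on ⊤) , λ u v u~v → proj₂ (colourable-on ⊤) ∈⊤ ∈⊤ u~v

corollary1 : (G : Graph) → Connected G →
    Free G claw × Free G diamond × Free G net →
    Contains G (K 4) ⊎ Colorable 3 G
corollary1 G _ (claw-free , diamond-free , net-free) =
  Sum.map₂ (Forbidden.three-colourable G claw-free diamond-free net-free) (contains-K4-or-free G)
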